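{- Let $n\ge 1$ and $m\ge 1$ be integers, let $p$ be a prime with $p>n$, and let $V$ be the $n\times m$ integer matrix with entries in $\{1,\dots,p\}$ such that $V_{ij}\equiv i^{j-1}\pmod p$ for all $i\in\{1,\dots,n\}$, $j\in\{1,\dots,m\}$. Let $A,B,C$ be $n\times n$ integer matrices and $M=AB-C$. Then: (i) every nonzero row $\mathbf{u}$ of $M$ (viewed as a $1\times n$ row vector) having at most $m$ nonzero entries satisfies $\mathbf{u}V\neq\mathbf{0}$; (ii) every nonzero column $\mathbf{u}$ of $M$ (viewed as an $n\times 1$ column vector) having at most $m$ nonzero entries satisfies $\mathbf{u}^TV\neq\mathbf{0}$.
   Context: The matrix $V$ is called an $m$-certificate; a nonzero row $\mathbf{u}$ (resp. column) of $AB-C$ with $\mathbf{u}V\ne\mathbf{0}$ (resp. $\mathbf{u}^TV\neq\mathbf 0$) is called $V$-detectable. All products are ordinary matrix products over the integers. -}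

module Defs where

open import Data.Nat as ℕ using (ℕ; zero; suc)
open import Data.Fin using (Fin; zero; suc)
open import Data.Integer as ℤ using (ℤ; +_)
open import Relation.Nullary.Decidable using (Dec; yes; no)
open import Data.Product using (∃)
open import Relation.Binary.PropositionalEquality using (_≢_)

-- integer matrices of size r × c, indexed by Fin r, Fin c (0-based)
Mat : ℕ → ℕ → Set
Mat r c = Fin r → Fin c → ℤ

Vect : ℕ → Set
Vect k = Fin k → ℤ

Σ : (k : ℕ) → (Fin k → ℤ) → ℤ
Σ zero    f = + 0
Σ (suc k) f = f zero ℤ.+ Σ k (λ i → f (suc i))

_⊗_ : ∀ {r s c} → Mat r s → Mat s c → Mat r c
_⊗_ {s = s} A B i j = Σ s (λ k → A i k ℤ.* B k j)

_⊖_ : ∀ {r c} → Mat r c → Mat r c → Mat r c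
(A ⊖ B) i j = A i j ℤ.- B i j

_·ᵥ_ : ∀ {k c} → Vect k → Mat k c → Vect c
_·ᵥ_ {k = k} u V j = Σ k (λ i → u i ℤ.* V i j)

row : ∀ {r c} → Mat r c → Fin r → Vect c
row M i = λ j → M i j

col : ∀ {r c} → Mat r c → Fin c → Vect r
col M j = λ i → M i j

0ᵥ : ∀ {k} → Vect k
0ᵥ _ = + 0

nnz : ∀ {k} → Vect k → ℕ
nnz {zero}  u = 0
nnz {suc k} u with u zero ℤ.≟ + 0
... | yes _ = nnz (λ i → u (suc i))
... | no  _ = suc (nnz (λ i → u (suc i)))

NonZeroᵥ : ∀ {k} → Vect k → Set
NonZeroᵥ u = ∃ λ i → u i ≢ + 0

-- Suppose u·V = 0 with at most m nonzero entries. Reducing modulo p, the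
-- first m power sums Σₗ uₗ xₗʲ (xₗ = l + 1) vanish, and since the nodes xₗ
-- are distinct modulo p, a Vandermonde-type induction on the number of
-- nonzero entries shows that p divides every uₗ. The vector u / p again lies
-- in the sparse kernel of V, so by infinite descent u = 0.
module Submission where

open import Defs
open import Data.Nat using (ℕ; suc; _^_; _≤_; _<_; _≥_)
open import Data.Nat.Primality using (Prime)
open import Data.Fin using (Fin; toℕ)
open import Data.Integer using (ℤ; +_; _-_)
open import Data.Integer.Divisibility using (_∣_)
open import Data.Product using (_×_)
open import Relation.Binary.PropositionalEquality using (_≡_)

open import Data.Nat using (zero)
open import Data.Fin using (zero; suc)
import Data.Nat as ℕ
import Data.Nat.Properties as ℕ
import Data.Nat.Divisibility as ℕ
import Data.Nat.Primality as ℕ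
import Data.Integer as ℤ
import Data.Integer.Properties as ℤ
import Data.Fin as Fin
import Data.Fin.Properties as Fin
open import Data.Integer using (0ℤ; 1ℤ; ∣_∣; _≟_; _+_; _*_)
open import Data.Integer.Divisibility.Signed as ℤ∣ using ()
  renaming (_∣_ to _∣ℤ_)
open import Data.Integer.Tactic.RingSolver using (solve-∀)
open import Data.Product using (_,_; ∃)
open import Data.Sum using (_⊎_; [_,_]′) renaming (map to map-⊎)
open import Function using (id; _∘_)
open import Relation.Nullary using (¬_; yes; no; contradiction)
open import Relation.Binary.PropositionalEquality
  using (_≢_; refl; sym; trans; cong; cong₂; subst; module ≡-Reasoning)

private
  variable
    k n m : ℕ

Σ-cong : ∀ {f g : Fin k → ℤ} → (∀ i → f i ≡ g i) → Σ k f ≡ Σ k g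
Σ-cong {zero}  eq = refl
Σ-cong {suc k} eq = cong₂ _+_ (eq zero) (Σ-cong (λ i → eq (suc i)))

Σ-distrib-- : ∀ (f g : Fin k → ℤ) → Σ k (λ i → f i - g i) ≡ Σ k f - Σ k g
Σ-distrib-- {zero}  f g = refl
Σ-distrib-- {suc k} f g =
  trans (cong (_+_ (f zero - g zero)) (Σ-distrib-- (λ i → f (suc i)) (λ i → g (suc i))))
        (interchange (f zero) (g zero) _ _)
  where
  interchange : ∀ a b s t → (a - b) + (s - t) ≡ (a + s) - (b + t)
  interchange = solve-∀

*-distribˡ-Σ : ∀ c (f : Fin k → ℤ) → c * Σ k f ≡ Σ k (λ i → c * f i)
*-distribˡ-Σ {zero}  c f = ℤ.*-zeroʳ c
*-distribˡ-Σ {suc k} c f =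
  trans (ℤ.*-distribˡ-+ c (f zero) _)
        (cong (_+_ (c * f zero)) (*-distribˡ-Σ c (λ i → f (suc i))))

pos-^ : ∀ a j → + (a ^ j) ≡ (+ a) ℤ.^ j
pos-^ a zero    = refl
pos-^ a (suc j) = trans (ℤ.pos-* a (a ^ j)) (cong (_*_ (+ a)) (pos-^ a j))

∣x∣<∣x*p∣ : ∀ x {p} → x ≢ 0ℤ → 1 < p → ∣ x ∣ < ∣ x * + p ∣
∣x∣<∣x*p∣ x {p} x≢0 1<p = subst (∣ x ∣ <_) (sym (ℤ.abs-* x (+ p)))
  (ℕ.m<m*n ∣ x ∣ p {{ℕ.≢-nonZero (λ ∣x∣≡0 → x≢0 (ℤ.∣i∣≡0⇒i≡0 ∣x∣≡0))}} 1<p)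

module _ {q} {p : ℕ} (1<p : 1 < p) (Q : ℤ → Set q)
         (divide : ∀ {x} → Q x → ∃ λ y → Q y × x ≡ y * + p) where

  private
    bounded : ∀ N {x} → ∣ x ∣ ≤ N → Q x → x ≡ 0ℤ
    bounded zero    ∣x∣≤0 _ = ℤ.∣i∣≡0⇒i≡0 (ℕ.n≤0⇒n≡0 ∣x∣≤0)
    bounded (suc N) ∣x∣≤N+1 Qx with divide Qx
    ... | y , Qy , refl with y ≟ 0ℤ
    ...   | yes refl = refl
    ...   | no y≢0   = cong (_* + p)
                         (bounded N (ℕ.≤-pred (ℕ.≤-trans (∣x∣<∣x*p∣ y y≢0 1<p) ∣x∣≤N+1)) Qy)

  divisible-closed⇒≡0 : ∀ {x} → Q x → x ≡ 0ℤ
  divisible-closed⇒≡0 {x} = bounded ∣ x ∣ ℕ.≤-refl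

_⊆ₛ_ : Vect k → Vect k → Set
w ⊆ₛ u = ∀ i → u i ≡ 0ℤ → w i ≡ 0ℤ

nnz-mono : ∀ {u w : Vect k} → w ⊆ₛ u → nnz w ≤ nnz u
nnz-mono {zero}          _   = ℕ.z≤n
nnz-mono {suc k} {u} {w} w⊆u with u zero ≟ 0ℤ | w zero ≟ 0ℤ
... | yes u₀≡0 | no w₀≢0 = contradiction (w⊆u zero u₀≡0) w₀≢0
... | yes _    | yes _   = nnz-mono (λ i → w⊆u (suc i))
... | no _     | yes _   = ℕ.m≤n⇒m≤1+n (nnz-mono (λ i → w⊆u (suc i)))
... | no _     | no _    = ℕ.s≤s (nnz-mono (λ i → w⊆u (suc i)))

nnz-mono-< : ∀ {u w : Vect k} → w ⊆ₛ u → ∀ i → u i ≢ 0ℤ → w i ≡ 0ℤ → nnz w < nnz u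
nnz-mono-< {suc k} {u} {w} w⊆u i uᵢ≢0 wᵢ≡0 with u zero ≟ 0ℤ | w zero ≟ 0ℤ | i
... | yes u₀≡0 | no w₀≢0 | _     = contradiction (w⊆u zero u₀≡0) w₀≢0
... | yes u₀≡0 | _       | zero  = contradiction u₀≡0 uᵢ≢0
... | no _     | no w₀≢0 | zero  = contradiction wᵢ≡0 w₀≢0
... | no _     | yes _   | zero  = ℕ.s≤s (nnz-mono (λ l → w⊆u (suc l)))
... | yes _    | yes _   | suc i = nnz-mono-< (λ l → w⊆u (suc l)) i uᵢ≢0 wᵢ≡0
... | no _     | yes _   | suc i = ℕ.m<n⇒m<1+n (nnz-mono-< (λ l → w⊆u (suc l)) i uᵢ≢0 wᵢ≡0)
... | no _     | no _    | suc i = ℕ.s≤s (nnz-mono-< (λ l → w⊆u (suc l)) i uᵢ≢0 wᵢ≡0)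

moment : (Fin n → ℤ) → Vect n → ℕ → ℤ
moment {n} x u j = Σ n (λ l → u l * x l ℤ.^ j)

moment-shift : ∀ (x : Fin n → ℤ) u c j →
  moment x (λ l → u l * (x l - c)) j ≡ moment x u (suc j) - c * moment x u j
moment-shift {n} x u c j = begin
  moment x (λ l → u l * (x l - c)) j
    ≡⟨ Σ-cong (λ l → expand (u l) (x l) c (x l ℤ.^ j)) ⟩
  Σ n (λ l → u l * x l ℤ.^ suc j - c * (u l * x l ℤ.^ j))
    ≡⟨ Σ-distrib-- (λ l → u l * x l ℤ.^ suc j) (λ l → c * (u l * x l ℤ.^ j)) ⟩
  moment x u (suc j) - Σ n (λ l → c * (u l * x l ℤ.^ j))
    ≡⟨ cong (moment x u (suc j) -_) (*-distribˡ-Σ c (λ l → u l * x l ℤ.^ j)) ⟨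
  moment x u (suc j) - c * moment x u j ∎
  where
  open ≡-Reasoning
  expand : ∀ a y c z → a * (y - c) * z ≡ a * (y * z) - c * (a * z)
  expand = solve-∀

module Modulo (p : ℕ) (p-prime : Prime p) where

  p∣0 : + p ∣ℤ 0ℤ
  p∣0 = ℤ∣.divides 0ℤ refl

  euclidsLemma : ∀ a b → + p ∣ℤ a * b → + p ∣ℤ a ⊎ + p ∣ℤ b
  euclidsLemma a b p∣ab =
    map-⊎ ℤ∣.∣ᵤ⇒∣ ℤ∣.∣ᵤ⇒∣
      (ℕ.euclidsLemma ∣ a ∣ ∣ b ∣ p-prime (subst (p ℕ.∣_) (ℤ.abs-* a b) (ℤ∣.∣⇒∣ᵤ p∣ab)))

  ∣Σ : ∀ {f : Fin k → ℤ} → (∀ l → + p ∣ℤ f l) → + p ∣ℤ Σ k f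
  ∣Σ {zero}  _   = p∣0
  ∣Σ {suc k} p∣f = ℤ∣.∣m∣n⇒∣m+n (p∣f zero) (∣Σ (λ l → p∣f (suc l)))

  ∣Σ-isolate : ∀ (f : Fin k → ℤ) i → (∀ l → l ≢ i → + p ∣ℤ f l) →
               + p ∣ℤ Σ k f → + p ∣ℤ f i
  ∣Σ-isolate {suc k} f zero others p∣Σ =
    ℤ∣.∣m+n∣n⇒∣m p∣Σ (∣Σ (λ l → others (suc l) (λ ())))
  ∣Σ-isolate {suc k} f (suc i) others p∣Σ =
    ∣Σ-isolate (λ l → f (suc l)) i
      (λ l l≢i → others (suc l) (λ eq → l≢i (Fin.suc-injective eq)))
      (ℤ∣.∣m+n∣m⇒∣n p∣Σ (others zero (λ ())))

  -- Vandermonde argument modulo p: pivot on a nonzero entry uᵢ and multiply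
  -- every uₗ by (xₗ - xᵢ), which kills uᵢ and shifts the moments.
  sparse-moments⇒∣ : (x : Fin n → ℤ) → (∀ {l i} → l ≢ i → ¬ (+ p ∣ℤ x l - x i)) →
    ∀ k (u : Vect n) → nnz u ≤ k → (∀ j → j < k → + p ∣ℤ moment x u j) →
    ∀ i → + p ∣ℤ u i
  sparse-moments⇒∣ x distinct k u nnz≤k p∣moments i with u i ≟ 0ℤ
  ... | yes uᵢ≡0 = subst (+ p ∣ℤ_) (sym uᵢ≡0) p∣0
  sparse-moments⇒∣ x distinct zero u nnz≤0 _ i | no uᵢ≢0 =
    contradiction (ℕ.≤-trans (nnz-mono-< (λ _ _ → refl) i uᵢ≢0 refl) nnz≤0) λ ()
  sparse-moments⇒∣ {n} x distinct (suc k) u nnz≤k+1 p∣moments i | no uᵢ≢0 =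
    subst (+ p ∣ℤ_) (ℤ.*-identityʳ (u i))
      (∣Σ-isolate (λ l → u l * 1ℤ) i p∣others (p∣moments 0 (ℕ.s≤s ℕ.z≤n)))
    where
    u′ : Vect n
    u′ l = u l * (x l - x i)

    u′⊆u : u′ ⊆ₛ u
    u′⊆u l uₗ≡0 = trans (cong (_* (x l - x i)) uₗ≡0) (ℤ.*-zeroˡ (x l - x i))

    u′ᵢ≡0 : u′ i ≡ 0ℤ
    u′ᵢ≡0 = trans (cong (u i *_) (ℤ.+-inverseʳ (x i))) (ℤ.*-zeroʳ (u i))

    p∣u′ : ∀ l → + p ∣ℤ u′ l
    p∣u′ = sparse-moments⇒∣ x distinct k u′
      (ℕ.≤-pred (ℕ.≤-trans (nnz-mono-< u′⊆u i uᵢ≢0 u′ᵢ≡0) nnz≤k+1))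
      (λ j j<k → subst (+ p ∣ℤ_) (sym (moment-shift x u (x i) j))
        (ℤ∣.∣m∣n⇒∣m-n (p∣moments (suc j) (ℕ.s≤s j<k))
                      (ℤ∣.∣n⇒∣m*n (x i) (p∣moments j (ℕ.m<n⇒m<1+n j<k)))))

    p∣others : ∀ l → l ≢ i → + p ∣ℤ u l * 1ℤ
    p∣others l l≢i = subst (+ p ∣ℤ_) (sym (ℤ.*-identityʳ (u l)))
      ([ id , (λ p∣xₗ-xᵢ → contradiction p∣xₗ-xᵢ (distinct l≢i)) ]′
         (euclidsLemma (u l) (x l - x i) (p∣u′ l)))

  distinct-residues : ∀ {a b} → a < p → b < p → a ≢ b → ¬ (+ p ∣ℤ + a - + b)
  distinct-residues {a} {b} a<p b<p a≢b p∣a-b =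
    ℕ.>⇒∤ {{ℕ.≢-nonZero ∣a-b∣≢0}} (ℕ.≤-<-trans ∣a-b∣≤a⊔b (ℕ.⊔-pres-<m a<p b<p))
      (ℤ∣.∣⇒∣ᵤ p∣a-b)
    where
    ∣a-b∣≤a⊔b : ∣ + a - + b ∣ ≤ a ℕ.⊔ b
    ∣a-b∣≤a⊔b = subst (_≤ a ℕ.⊔ b) (cong ∣_∣ (sym (ℤ.m-n≡m⊖n a b))) (ℤ.∣m⊝n∣≤m⊔n a b)

    ∣a-b∣≢0 : ∣ + a - + b ∣ ≢ 0
    ∣a-b∣≢0 ∣a-b∣≡0 = a≢b (ℤ.+-injective (ℤ.i-j≡0⇒i≡j (+ a) (+ b) (ℤ.∣i∣≡0⇒i≡0 ∣a-b∣≡0)))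

  suc-toℕ-distinct-residues : n < p → ∀ {l i : Fin n} → l ≢ i →
    ¬ (+ p ∣ℤ + suc (toℕ l) - + suc (toℕ i))
  suc-toℕ-distinct-residues n<p {l} {i} l≢i =
    distinct-residues (suc-toℕ<p l) (suc-toℕ<p i)
      (λ eq → l≢i (Fin.toℕ-injective (ℕ.suc-injective eq)))
    where
    suc-toℕ<p : ∀ (l : Fin _) → suc (toℕ l) < p
    suc-toℕ<p l = ℕ.≤-<-trans (Fin.toℕ<n l) n<p

  p≢0 : + p ≢ 0ℤ
  p≢0 = ℕ.≢-nonZero⁻¹ p {{ℕ.prime⇒nonZero p-prime}} ∘ ℤ.+-injective

  *p≡0⇒≡0 : ∀ w → w * + p ≡ 0ℤ → w ≡ 0ℤ
  *p≡0⇒≡0 w eq = [ id , (λ p≡0 → contradiction p≡0 p≢0) ]′ (ℤ.i*j≡0⇒i≡0∨j≡0 w eq)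

  module SparseKernel (x : Fin n → ℤ) (distinct : ∀ {l i} → l ≢ i → ¬ (+ p ∣ℤ x l - x i))
                      (V : Mat n m) (V≡powers : ∀ l j → + p ∣ℤ V l j - x l ℤ.^ toℕ j) where

    Kernel : Vect n → Set
    Kernel u = (∀ j → (u ·ᵥ V) j ≡ 0ℤ) × nnz u ≤ m

    annihilated⇒∣moment : ∀ {u} → (∀ j → (u ·ᵥ V) j ≡ 0ℤ) → ∀ j → + p ∣ℤ moment x u (toℕ j)
    annihilated⇒∣moment {u} u·V≡0 j =
      subst (+ p ∣ℤ_) (ℤ.neg-involutive (moment x u (toℕ j)))
        (ℤ∣.∣m⇒∣-m (subst (+ p ∣ℤ_) error≡-moment (∣Σ (λ l → ℤ∣.∣n⇒∣m*n (u l) (V≡powers l j)))))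
      where
      open ≡-Reasoning
      distrib : ∀ a b c → a * (b - c) ≡ a * b - a * c
      distrib = solve-∀

      error≡-moment : Σ _ (λ l → u l * (V l j - x l ℤ.^ toℕ j)) ≡ ℤ.- moment x u (toℕ j)
      error≡-moment = begin
        Σ _ (λ l → u l * (V l j - x l ℤ.^ toℕ j))
          ≡⟨ Σ-cong (λ l → distrib (u l) (V l j) (x l ℤ.^ toℕ j)) ⟩
        Σ _ (λ l → u l * V l j - u l * x l ℤ.^ toℕ j)
          ≡⟨ Σ-distrib-- (λ l → u l * V l j) (λ l → u l * x l ℤ.^ toℕ j) ⟩
        (u ·ᵥ V) j - moment x u (toℕ j)
          ≡⟨ cong (_- moment x u (toℕ j)) (u·V≡0 j) ⟩
        0ℤ - moment x u (toℕ j)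
          ≡⟨ ℤ.+-identityˡ _ ⟩
        ℤ.- moment x u (toℕ j) ∎

    kernel-divisible : ∀ {u} → Kernel u → ∀ l → + p ∣ℤ u l
    kernel-divisible {u} (u·V≡0 , nnz≤m) =
      sparse-moments⇒∣ x distinct m u nnz≤m λ j j<m →
        subst (λ j → + p ∣ℤ moment x u j) (Fin.toℕ-fromℕ< j<m)
          (annihilated⇒∣moment {u} u·V≡0 (Fin.fromℕ< j<m))

    kernel-divide : ∀ {u} → Kernel u → ∃ λ w → Kernel w × ∀ l → u l ≡ w l * + p
    kernel-divide {u} K@(u·V≡0 , nnz≤m) = w , (w·V≡0 , ℕ.≤-trans (nnz-mono w⊆u) nnz≤m) , u≡w*p
      where
      w : Vect n
      w l = ℤ∣.quotient (kernel-divisible K l)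

      u≡w*p : ∀ l → u l ≡ w l * + p
      u≡w*p l = ℤ∣._∣_.equality (kernel-divisible K l)

      w⊆u : w ⊆ₛ u
      w⊆u l uₗ≡0 = *p≡0⇒≡0 (w l) (trans (sym (u≡w*p l)) uₗ≡0)

      reassociate : ∀ a b c → b * (a * c) ≡ a * b * c
      reassociate = solve-∀

      w·V≡0 : ∀ j → (w ·ᵥ V) j ≡ 0ℤ
      w·V≡0 j = *p≡0⇒≡0 ((w ·ᵥ V) j) (begin
        (w ·ᵥ V) j * + p          ≡⟨ ℤ.*-comm ((w ·ᵥ V) j) (+ p) ⟩
        + p * (w ·ᵥ V) j          ≡⟨ *-distribˡ-Σ (+ p) (λ l → w l * V l j) ⟩
        Σ n (λ l → + p * (w l * V l j))
          ≡⟨ Σ-cong (λ l → trans (reassociate (w l) (+ p) (V l j))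
                                 (cong (_* V l j) (sym (u≡w*p l)))) ⟩
        (u ·ᵥ V) j                ≡⟨ u·V≡0 j ⟩
        0ℤ                        ∎)
        where open ≡-Reasoning

    kernel-trivial : ∀ {u} → Kernel u → ∀ i → u i ≡ 0ℤ
    kernel-trivial {u} K i =
      divisible-closed⇒≡0 (ℕ.nonTrivial⇒n>1 p {{ℕ.prime⇒nonTrivial p-prime}})
        (λ y → ∃ λ u → Kernel u × u i ≡ y) divide (u , K , refl)
      where
      divide : ∀ {y} → (∃ λ u → Kernel u × u i ≡ y) →
               ∃ λ z → (∃ λ u → Kernel u × u i ≡ z) × y ≡ z * + p
      divide (u , K , refl) =
        let w , Kw , u≡w*p = kernel-divide K in w i , (w , Kw , refl) , u≡w*p i

    detectable : ∀ {u} → NonZeroᵥ u → nnz u ≤ m → NonZeroᵥ (u ·ᵥ V)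
    detectable {u} (i , uᵢ≢0) nnz≤m =
      Fin.¬∀⟶∃¬ m (λ j → (u ·ᵥ V) j ≡ 0ℤ) (λ j → (u ·ᵥ V) j ≟ 0ℤ)
        (λ u·V≡0 → uᵢ≢0 (kernel-trivial (u·V≡0 , nnz≤m) i))

lemma2 : (n m p : ℕ) → n ≥ 1 → m ≥ 1 → Prime p → n < p →
    (V : Mat n m) →
    (∀ i j → (+ 1 Data.Integer.≤ V i j) × (V i j Data.Integer.≤ + p)) →
    (∀ (i : Fin n) (j : Fin m) → (+ p) ∣ (V i j - + (suc (toℕ i) ^ toℕ j))) →
    (A B C : Mat n n) →
    ((i : Fin n) → NonZeroᵥ (row ((A ⊗ B) ⊖ C) i) → nnz (row ((A ⊗ B) ⊖ C) i) ≤ m →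
    NonZeroᵥ (row ((A ⊗ B) ⊖ C) i ·ᵥ V))
    ×
    ((j : Fin n) → NonZeroᵥ (col ((A ⊗ B) ⊖ C) j) → nnz (col ((A ⊗ B) ⊖ C) j) ≤ m →
    NonZeroᵥ (col ((A ⊗ B) ⊖ C) j ·ᵥ V))
lemma2 n m p _ _ p-prime n<p V _ V≡powers A B C =
  (λ i → detectable {row M i}) , (λ j → detectable {col M j})
  where
  open Modulo p p-prime
  open SparseKernel (λ l → + suc (toℕ l)) (suc-toℕ-distinct-residues n<p) V
    (λ l j → subst (λ y → + p ∣ℤ V l j - y) (pos-^ (suc (toℕ l)) (toℕ j))
                   (ℤ∣.∣ᵤ⇒∣ (V≡powers l j)))

  M : Mat n n
  M = (A ⊗ B) ⊖ C
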